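{- Let $G=(V,E)$ be an undirected graph with $m=|E|$ and $V=\{0,\dots,n-1\}$, and let $S\subseteq V$. Let $C=\{v:\deg_G(v)>m^{1/2}\}$, $B=\{v: m^{1/4}<\deg_G(v)\le m^{1/2}\}$, $A=\{v:\deg_G(v)\le m^{1/4}\}$, and $V_C=C\cap S$, $V_B=B\cap S$, $V_A=A\cap S$. Let $G_A$ be the subgraph of $G$ induced by $V_A$, and let $G^*$ be the graph constructed from these data as described in the context. Then for any two vertices $u,v\in V_B\cup V_C$, $u$ and $v$ are connected in the subgraph of $G$ induced by $S$ if and only if they are connected in $G^*$.
   Context: Degree of a component $P$ of $G_A$: $\sum_{v\in P}\deg_G(v)$ (degrees in $G$). $P$ is high if its degree exceeds $m^{1/4}$, low otherwise. Fix a spanning forest $F_A$ of $G_A$; each component has a spanning tree $T$ in $F_A$, and the vertices of $T$ are given a fixed linear order (the Euler-tour order of $T$). Path graph of $V_B$ w.r.t. $T$: let $w_1,\dots,w_k$ be the vertices of $T$ having at least one neighbor (in $G$) in $V_B$, in the order of $T$; for each $w_i$ list its neighbors in $V_B$ in increasing order; concatenating these lists gives a sequence $x_1,\dots,x_r$ of vertices of $V_B$ (repetitions allowed), and the path graph consists of the artificial edges $(x_j,x_{j+1})$, $1\le j<r$; $x_1$ (if $r\ge1$) is called the first vertex of the path graph. Multigraph $H$: vertex set $V_B\cup C\cup M$, where $M$ contains one new meta-vertex $p_P$ for each high component $P$ of $G_A$; edges are (i) the edges of $G$ with both ends in $V_B\cup C$; (ii) the path-graph edges for every spanning tree $T$ of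 $F_A$; (iii) for each high component $P$ with spanning tree $T$: an edge between $p_P$ and every $v\in C$ adjacent in $G$ to some vertex of $P$, and an edge between $p_P$ and the first vertex of the path graph w.r.t. $T$ (if it exists); (iv) for each low component $Q$ with spanning tree $T$: all edges of a complete graph on the set of vertices of $C$ adjacent in $G$ to some vertex of $Q$, and an edge between the first vertex of the path graph w.r.t. $T$ (if it exists) and each such vertex of $C$. $G^*$ is the simple graph with vertex set $V_B\cup V_C\cup M$ in which distinct $u,v$ are adjacent iff $H$ has at least one edge between $u$ and $v$. -}

module Defs where

open import Data.Nat using (ℕ; zero; suc; _+_; _*_; _^_; _<ᵇ_; _≤ᵇ_)
open import Data.Fin using (Fin; toℕ)
open import Data.Bool using (Bool; true; false; if_then_else_; _∧_; _∨_; not; T)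
open import Data.List using (List; []; _∷_; filterᵇ; concatMap; head; map)
open import Data.Nat.ListAction using (sum)
open import Data.List.Membership.Propositional using (_∈_)
open import Data.List.Relation.Unary.Unique.Propositional using (Unique)
open import Data.Maybe using (Maybe; just)
open import Data.Product using (Σ; ∃; _×_; _,_)
open import Data.Sum using (_⊎_; inj₁; inj₂)
open import Data.Empty using (⊥)
open import Relation.Nullary using (¬_)
open import Relation.Binary.PropositionalEquality using (_≡_)
open import Relation.Binary.Construct.Closure.ReflexiveTransitive using (Star)
open import Data.Fin using (zero; suc)
open import Data.List using (allFin)

record Graph (n : ℕ) : Set where
  field
    adj    : Fin n → Fin n → Bool
    sym    : ∀ u v → adj u v ≡ adj v u
    irrefl : ∀ v → adj v v ≡ false
open Graph public

sumF : ∀ {n} → (Fin n → ℕ) → ℕ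
sumF {zero}  f = 0
sumF {suc n} f = f zero + sumF (λ i → f (suc i))

countF : ∀ {n} → (Fin n → Bool) → ℕ
countF p = sumF (λ i → if p i then 1 else 0)

module Construction {n : ℕ} (G : Graph n) (S : Fin n → Bool) where

  deg : Fin n → ℕ
  deg v = countF (adj G v)

  m : ℕ
  m = sumF (λ u → countF (λ v → (toℕ u <ᵇ toℕ v) ∧ adj G u v))

  -- C : deg > m^{1/2}   ⇔  deg² > m
  inC : Fin n → Bool
  inC v = m <ᵇ deg v * deg v

  -- A : deg ≤ m^{1/4}   ⇔  deg⁴ ≤ m
  inA : Fin n → Bool
  inA v = (deg v ^ 4) ≤ᵇ m

  inB : Fin n → Bool
  inB v = not (inA v) ∧ not (inC v)

  VC VB VA : Fin n → Bool
  VC v = inC v ∧ S v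
  VB v = inB v ∧ S v
  VA v = inA v ∧ S v

  inBC : Fin n → Bool
  inBC v = VB v ∨ VC v

  InducedEdge : (Fin n → Bool) → Fin n → Fin n → Set
  InducedEdge P u v = T (P u) × T (P v) × T (adj G u v)

  ConnIn : (Fin n → Bool) → Fin n → Fin n → Set
  ConnIn P u v = T (P u) × T (P v) × Star (InducedEdge P) u v

  -- A decomposition of V_A into the connected components of G_A, each
  -- component given as the list of its vertices in the fixed linear order
  -- of its spanning tree.
  record IsComponentDecomp (k : ℕ) (comp : Fin k → List (Fin n)) : Set where
    field
      nonempty  : ∀ i → Σ (Fin n) (λ v → v ∈ comp i)
      inVA      : ∀ i v → v ∈ comp i → T (VA v)
      linear    : ∀ i → Unique (comp i)
      covers    : ∀ v → T (VA v) → Σ (Fin k) (λ i → v ∈ comp i)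
      disjoint  : ∀ i j v → v ∈ comp i → v ∈ comp j → i ≡ j
      connected : ∀ i u v → u ∈ comp i → v ∈ comp i → ConnIn VA u v
      closed    : ∀ i u v → u ∈ comp i → ConnIn VA u v → v ∈ comp i

  module _ {k : ℕ} (comp : Fin k → List (Fin n)) where

    compDeg : Fin k → ℕ
    compDeg i = sum (map deg (comp i))

    -- high : degree > m^{1/4}  ⇔  degree⁴ > m
    high : Fin k → Bool
    high i = m <ᵇ (compDeg i ^ 4)

    -- the sequence x_1,…,x_r of the path graph of V_B w.r.t. the tree of comp i
    pathSeq : Fin k → List (Fin n)
    pathSeq i = concatMap (λ w → filterᵇ (λ x → adj G w x ∧ VB x) (allFin n)) (comp i)

    data Consec : List (Fin n) → Fin n → Fin n → Set where
      here  : ∀ {x y xs} → Consec (x ∷ y ∷ xs) x y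
      there : ∀ {x xs a b} → Consec xs a b → Consec (x ∷ xs) a b

    CNbr : Fin k → Fin n → Set
    CNbr i v = T (VC v) × Σ (Fin n) (λ w → w ∈ comp i × T (adj G w v))

    -- vertices of H / G* : original vertices (inj₁) and meta-vertices (inj₂)
    Vtx : Set
    Vtx = Fin n ⊎ Fin k

    -- the (directed presentation of the) edges of the multigraph H
    data HEdge : Vtx → Vtx → Set where
      gEdge    : ∀ u v → T (inBC u) → T (inBC v) → T (adj G u v) → HEdge (inj₁ u) (inj₁ v)
      pathEdge : ∀ i x y → Consec (pathSeq i) x y → HEdge (inj₁ x) (inj₁ y)
      metaC    : ∀ i v → T (high i) → CNbr i v → HEdge (inj₂ i) (inj₁ v)
      metaFirst : ∀ i x → T (high i) → head (pathSeq i) ≡ just x → HEdge (inj₂ i) (inj₁ x)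
      lowClique : ∀ i u v → T (not (high i)) → CNbr i u → CNbr i v → HEdge (inj₁ u) (inj₁ v)
      lowFirst  : ∀ i x v → T (not (high i)) → head (pathSeq i) ≡ just x → CNbr i v
                  → HEdge (inj₁ x) (inj₁ v)

    InGStar : Vtx → Set
    InGStar (inj₁ v) = T (inBC v)
    InGStar (inj₂ i) = T (high i)

    GStarAdj : Vtx → Vtx → Set
    GStarAdj a b = InGStar a × InGStar b × ¬ (a ≡ b) × (HEdge a b ⊎ HEdge b a)

    ConnGStar : Vtx → Vtx → Set
    ConnGStar = Star GStarAdj

module Submission where

open import Defs
open import Data.Nat using (ℕ; zero; suc; _*_; _^_; _≤_; _<_)
open import Data.Nat.Properties using (<⇒≱; <ᵇ⇒<; ≤ᵇ⇒≤; ≤-trans; *-monoʳ-≤; m≤m*n)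
open import Data.Fin using (Fin; _≟_)
open import Data.Bool using (Bool; true; false; T; not; _∧_; _∨_; T?)
open import Data.Bool.Properties using (T-∧; T-∨)
open import Data.List using (List; _∷_; head; allFin; filterᵇ)
open import Data.List.Membership.Propositional using (_∈_; find; lose)
open import Data.List.Membership.Propositional.Properties
  using (∈-concatMap⁺; ∈-concatMap⁻; ∈-filter⁺; ∈-filter⁻; ∈-allFin)
open import Data.List.Relation.Unary.Any using (here; there)
open import Data.Maybe using (just)
open import Data.Product using (Σ; _×_; _,_; proj₁; proj₂)
open import Data.Sum using (_⊎_; inj₁; inj₂; swap)
open import Data.Sum.Properties using (≡-dec)
open import Data.Empty using (⊥-elim)
open import Function using (id)
open import Function.Bundles using (_⇔_; mk⇔; Equivalence)
open import Relation.Nullary using (¬_; yes; no)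
open import Relation.Binary.PropositionalEquality using (_≡_; refl; ≢-sym; subst)
open import Relation.Binary.Construct.Closure.ReflexiveTransitive
  using (Star; ε; _◅_; _◅◅_; gmap; reverse)

open Equivalence

-- Forward direction: along an S-path from u every vertex either lies in V_B ∪ V_C and is
-- G*-reachable from u, or lies in a component of G_A one of whose V_B ∪ V_C-neighbours is
-- G*-reachable from u. This invariant survives an edge between V_A and V_B ∪ V_C because all
-- V_B ∪ V_C-neighbours of one component are G*-connected: those in V_B along the path graph to
-- its first vertex, those in V_C through the meta-vertex (high component) or through the clique
-- and first-vertex edges (low component). The endpoint v is not in V_A since A and C are
-- disjoint (d⁴ ≤ m < d² is impossible).
-- Backward direction: each vertex of G* stands for a set of S-connected vertices of G (itself,
-- or a component of G_A), and every edge of H joins S-connected members of its two ends.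

d⁴≤m⇒m≮d*d : ∀ d m → d ^ 4 ≤ m → ¬ (m < d * d)
d⁴≤m⇒m≮d*d zero    m _    ()
d⁴≤m⇒m≮d*d (suc e) m d⁴≤m m<d² =
  <⇒≱ m<d² (≤-trans (*-monoʳ-≤ (suc e) (m≤m*n (suc e) (suc e ^ 2))) d⁴≤m)

T⊎T-not : ∀ b → T b ⊎ T (not b)
T⊎T-not true  = inj₁ _
T⊎T-not false = inj₂ _

head-∈ : ∀ {A : Set} (xs : List A) {x} → head xs ≡ just x → x ∈ xs
head-∈ (_ ∷ _) refl = here refl

∈⇒head≡just : ∀ {A : Set} {x : A} {xs} → x ∈ xs → Σ A λ h → head xs ≡ just h
∈⇒head≡just (here _)  = _ , refl
∈⇒head≡just (there _) = _ , refl

module GStarConnectivity {n : ℕ} (G : Graph n) (S : Fin n → Bool)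
                         {k : ℕ} (comp : Fin k → List (Fin n))
                         (D : Construction.IsComponentDecomp G S k comp) where
  open Construction G S
  open IsComponentDecomp D

  inBC⊎VA : ∀ v → T (S v) → T (inBC v) ⊎ T (VA v)
  inBC⊎VA v = split (inA v) (inC v) (S v)
    where
    split : ∀ a c s → T s → T (((not a ∧ not c) ∧ s) ∨ (c ∧ s)) ⊎ T (a ∧ s)
    split true  _     _    t = inj₂ t
    split false true  true _ = inj₁ _
    split false false true _ = inj₁ _

  inBC∧VA⇒inC : ∀ v → T (inBC v) → T (VA v) → T (inC v)
  inBC∧VA⇒inC v = go (inA v) (inC v) (S v)
    where
    go : ∀ a c s → T (((not a ∧ not c) ∧ s) ∨ (c ∧ s)) → T (a ∧ s) → T c
    go true  true  _ _ _ = _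
    go true  false _ () _
    go false _     _ _ ()

  inBC-VA-disjoint : ∀ v → T (inBC v) → ¬ T (VA v)
  inBC-VA-disjoint v bc va =
    d⁴≤m⇒m≮d*d (deg v) m (≤ᵇ⇒≤ (deg v ^ 4) m (proj₁ (to T-∧ va)))
      (<ᵇ⇒< m (deg v * deg v) (inBC∧VA⇒inC v bc va))

  inBC⇒S : ∀ v → T (inBC v) → T (S v)
  inBC⇒S v bc with to (T-∨ {VB v}) bc
  ... | inj₁ vb = proj₂ (to (T-∧ {inB v}) vb)
  ... | inj₂ vc = proj₂ (to (T-∧ {inC v}) vc)

  VA⇒S : ∀ v → T (VA v) → T (S v)
  VA⇒S v va = proj₂ (to (T-∧ {inA v}) va)

  VB⇒inBC : ∀ v → T (VB v) → T (inBC v)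
  VB⇒inBC v vb = from (T-∨ {VB v}) (inj₁ vb)

  VC⇒inBC : ∀ v → T (VC v) → T (inBC v)
  VC⇒inBC v vc = from (T-∨ {VB v}) (inj₂ vc)

  Attached : Fin k → Fin n → Set
  Attached i x = Σ (Fin n) λ w → w ∈ comp i × T (adj G w x)

  private
    pathNbrs : Fin n → List (Fin n)
    pathNbrs w = filterᵇ (λ x → adj G w x ∧ VB x) (allFin n)

  ∈-pathSeq⁺ : ∀ i {x} → T (VB x) → Attached i x → x ∈ pathSeq comp i
  ∈-pathSeq⁺ i {x} vb (w , w∈ , wx) =
    ∈-concatMap⁺ pathNbrs
      (lose w∈ (∈-filter⁺ (λ y → T? (adj G w y ∧ VB y)) (∈-allFin x) (from T-∧ (wx , vb))))

  ∈-pathSeq⁻ : ∀ i {x} → x ∈ pathSeq comp i → T (VB x) × Attached i x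
  ∈-pathSeq⁻ i {x} x∈ with find (∈-concatMap⁻ pathNbrs {xs = comp i} x∈)
  ... | w , w∈ , x∈nbrs
    with to T-∧ (proj₂ (∈-filter⁻ (λ y → T? (adj G w y ∧ VB y)) {xs = allFin n} x∈nbrs))
  ...   | wx , vb = vb , w , w∈ , wx

  Consec⇒∈ : ∀ {xs a b} → Consec comp xs a b → a ∈ xs × b ∈ xs
  Consec⇒∈ here      = here refl , there (here refl)
  Consec⇒∈ (there c) with Consec⇒∈ c
  ... | a∈ , b∈ = there a∈ , there b∈

  GStarAdj-sym : ∀ {a b} → GStarAdj comp a b → GStarAdj comp b a
  GStarAdj-sym (ia , ib , a≢b , e) = ib , ia , ≢-sym a≢b , swap e

  ConnGStar-sym : ∀ {a b} → ConnGStar comp a b → ConnGStar comp b a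
  ConnGStar-sym = reverse GStarAdj-sym

  HEdge⇒ConnGStar : ∀ {a b} → InGStar comp a → InGStar comp b → HEdge comp a b → ConnGStar comp a b
  HEdge⇒ConnGStar {a} {b} ia ib e with ≡-dec _≟_ _≟_ a b
  ... | yes refl = ε
  ... | no a≢b   = (ia , ib , a≢b , inj₁ e) ◅ ε

  _⟶*_ : Fin n → Fin n → Set
  x ⟶* y = ConnGStar comp (inj₁ x) (inj₁ y)

  pathSeq-⟶ : ∀ i {a b} → Consec comp (pathSeq comp i) a b → a ⟶* b
  pathSeq-⟶ i {a} {b} c with Consec⇒∈ c
  ... | a∈ , b∈ = HEdge⇒ConnGStar (VB⇒inBC a (proj₁ (∈-pathSeq⁻ i a∈)))
                                  (VB⇒inBC b (proj₁ (∈-pathSeq⁻ i b∈))) (pathEdge i a b c)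

  Consec-⟶*-from-head : ∀ x ys → (∀ {a b} → Consec comp (x ∷ ys) a b → a ⟶* b) →
                        ∀ {y} → y ∈ x ∷ ys → x ⟶* y
  Consec-⟶*-from-head x ys        step (here refl) = ε
  Consec-⟶*-from-head x (z ∷ zs) step (there y∈)   =
    step here ◅◅ Consec-⟶*-from-head z zs (λ c → step (there c)) y∈

  pathSeq-head-⟶* : ∀ i {h x} → head (pathSeq comp i) ≡ just h → x ∈ pathSeq comp i → h ⟶* x
  pathSeq-head-⟶* i eq x∈ with pathSeq comp i | pathSeq-⟶ i
  ... | h ∷ rest | step with refl ← eq = Consec-⟶*-from-head h rest step x∈

  pathSeq-head-inBC : ∀ i {h} → head (pathSeq comp i) ≡ just h → T (inBC h)
  pathSeq-head-inBC i {h} eq = VB⇒inBC h (proj₁ (∈-pathSeq⁻ i (head-∈ (pathSeq comp i) eq)))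

  pathSeq-head-⟶*-VC : ∀ i {h y} → head (pathSeq comp i) ≡ just h →
                       T (VC y) → Attached i y → h ⟶* y
  pathSeq-head-⟶*-VC i {h} {y} eq vc att with T⊎T-not (high comp i)
  ... | inj₁ hi = ConnGStar-sym (HEdge⇒ConnGStar hi (pathSeq-head-inBC i eq) (metaFirst i h hi eq))
                  ◅◅ HEdge⇒ConnGStar hi (VC⇒inBC y vc) (metaC i y hi (vc , att))
  ... | inj₂ lo = HEdge⇒ConnGStar (pathSeq-head-inBC i eq) (VC⇒inBC y vc) (lowFirst i h y lo eq (vc , att))

  pathSeq-head-⟶*-attached : ∀ i {h y} → head (pathSeq comp i) ≡ just h →
                             T (inBC y) → Attached i y → h ⟶* y
  pathSeq-head-⟶*-attached i {y = y} eq bc att with to (T-∨ {VB y}) bc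
  ... | inj₁ vb = pathSeq-head-⟶* i eq (∈-pathSeq⁺ i vb att)
  ... | inj₂ vc = pathSeq-head-⟶*-VC i eq vc att

  VC-attached-⟶* : ∀ i {x y} → T (VC x) → Attached i x → T (VC y) → Attached i y → x ⟶* y
  VC-attached-⟶* i {x} {y} vx ax vy ay with T⊎T-not (high comp i)
  ... | inj₁ hi = ConnGStar-sym (HEdge⇒ConnGStar hi (VC⇒inBC x vx) (metaC i x hi (vx , ax)))
                  ◅◅ HEdge⇒ConnGStar hi (VC⇒inBC y vy) (metaC i y hi (vy , ay))
  ... | inj₂ lo = HEdge⇒ConnGStar (VC⇒inBC x vx) (VC⇒inBC y vy) (lowClique i x y lo (vx , ax) (vy , ay))

  attached-⟶*-via-pathSeq : ∀ i {z x y} → z ∈ pathSeq comp i →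
                            T (inBC x) → Attached i x → T (inBC y) → Attached i y → x ⟶* y
  attached-⟶*-via-pathSeq i z∈ bx ax by ay with ∈⇒head≡just z∈
  ... | h , eq = ConnGStar-sym (pathSeq-head-⟶*-attached i eq bx ax) ◅◅ pathSeq-head-⟶*-attached i eq by ay

  attached-⟶* : ∀ i {x y} → T (inBC x) → Attached i x → T (inBC y) → Attached i y → x ⟶* y
  attached-⟶* i {x} {y} bx ax by ay with to (T-∨ {VB x}) bx | to (T-∨ {VB y}) by
  ... | inj₁ vx | _       = attached-⟶*-via-pathSeq i (∈-pathSeq⁺ i vx ax) bx ax by ay
  ... | inj₂ _  | inj₁ vy = attached-⟶*-via-pathSeq i (∈-pathSeq⁺ i vy ay) bx ax by ay
  ... | inj₂ vx | inj₂ vy = VC-attached-⟶* i vx ax vy ay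

  symmetric-adj : ∀ a b → T (adj G a b) → T (adj G b a)
  symmetric-adj a b = subst T (Graph.sym G a b)

  module Forward (u : Fin n) where

    Reached : Fin n → Set
    Reached a = (T (inBC a) × u ⟶* a)
              ⊎ (Σ (Fin k) λ i → a ∈ comp i × Σ (Fin n) λ x → T (inBC x) × Attached i x × u ⟶* x)

    Reached-step : ∀ {a b} → InducedEdge S a b → Reached a → Reached b
    Reached-step {a} {b} (_ , sb , ab) r with inBC⊎VA b sb | r
    ... | inj₁ bb | inj₁ (ba , u⟶a) = inj₁ (bb , u⟶a ◅◅ HEdge⇒ConnGStar ba bb (gEdge a b ba bb ab))
    ... | inj₁ bb | inj₂ (i , a∈ , x , bx , ax , u⟶x) =
      inj₁ (bb , u⟶x ◅◅ attached-⟶* i bx ax bb (a , a∈ , ab))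
    ... | inj₂ vb | inj₁ (ba , u⟶a) =
      let i , b∈ = covers b vb in inj₂ (i , b∈ , a , ba , (b , b∈ , symmetric-adj a b ab) , u⟶a)
    ... | inj₂ vb | inj₂ (i , a∈ , rest) =
      let va = inVA i a a∈ in inj₂ (i , closed i a b a∈ (va , vb , (va , vb , ab) ◅ ε) , rest)

    Reached-along : ∀ {a b} → Star (InducedEdge S) a b → Reached a → Reached b
    Reached-along ε        r = r
    Reached-along (e ◅ es) r = Reached-along es (Reached-step e r)

  ConnIn⇒ConnGStar : ∀ {u v} → T (inBC u) → T (inBC v) → ConnIn S u v → u ⟶* v
  ConnIn⇒ConnGStar {u} {v} bu bv (_ , _ , p) with Forward.Reached-along u p (inj₁ (bu , ε))
  ... | inj₁ (_ , u⟶v)    = u⟶v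
  ... | inj₂ (i , v∈ , _) = ⊥-elim (inBC-VA-disjoint v bv (inVA i v v∈))

  ConnIn-refl : ∀ {a} → T (S a) → ConnIn S a a
  ConnIn-refl sa = sa , sa , ε

  ConnIn-trans : ∀ {a b c} → ConnIn S a b → ConnIn S b c → ConnIn S a c
  ConnIn-trans (sa , _ , p) (_ , sc , q) = sa , sc , p ◅◅ q

  ConnIn-sym : ∀ {a b} → ConnIn S a b → ConnIn S b a
  ConnIn-sym (sa , sb , p) =
    sb , sa , reverse (λ { {x} {y} (sx , sy , xy) → sy , sx , symmetric-adj x y xy }) p

  adj⇒ConnIn : ∀ {a b} → T (S a) → T (S b) → T (adj G a b) → ConnIn S a b
  adj⇒ConnIn sa sb ab = sa , sb , (sa , sb , ab) ◅ ε

  comp-ConnIn : ∀ i {w w′} → w ∈ comp i → w′ ∈ comp i → ConnIn S w w′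
  comp-ConnIn i {w} {w′} w∈ w′∈ with connected i w w′ w∈ w′∈
  ... | vw , vw′ , p =
    VA⇒S w vw , VA⇒S w′ vw′ , gmap id (λ { {x} {y} (vx , vy , xy) → VA⇒S x vx , VA⇒S y vy , xy }) p

  attachment-ConnIn : ∀ i {x} → T (S x) → (a : Attached i x) → ConnIn S (proj₁ a) x
  attachment-ConnIn i sx (w , w∈ , wx) = adj⇒ConnIn (VA⇒S w (inVA i w w∈)) sx wx

  attached-ConnIn : ∀ i {x y} → T (S x) → Attached i x → T (S y) → Attached i y → ConnIn S x y
  attached-ConnIn i sx ax@(_ , w∈ , _) sy ay@(_ , w′∈ , _) =
    ConnIn-trans (ConnIn-sym (attachment-ConnIn i sx ax))
                 (ConnIn-trans (comp-ConnIn i w∈ w′∈) (attachment-ConnIn i sy ay))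

  pathSeq-S-attached : ∀ i {x} → x ∈ pathSeq comp i → T (S x) × Attached i x
  pathSeq-S-attached i {x} x∈ with ∈-pathSeq⁻ i x∈
  ... | vb , att = inBC⇒S x (VB⇒inBC x vb) , att

  Members : Vtx comp → Fin n → Set
  Members (inj₁ x) w = w ≡ x
  Members (inj₂ i) w = w ∈ comp i

  Members-ConnIn : ∀ a {w w′} → Members a w → Members a w′ → T (S w) → ConnIn S w w′
  Members-ConnIn (inj₁ x) refl refl sx = ConnIn-refl sx
  Members-ConnIn (inj₂ i) w∈   w′∈  _  = comp-ConnIn i w∈ w′∈

  Linked : Vtx comp → Vtx comp → Set
  Linked a b = Σ (Fin n) λ w → Σ (Fin n) λ w′ → Members a w × Members b w′ × ConnIn S w w′

  Linked-sym : ∀ {a b} → Linked a b → Linked b a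
  Linked-sym (w , w′ , w∈a , w′∈b , p) = w′ , w , w′∈b , w∈a , ConnIn-sym p

  attached-Linked : ∀ i {x y} → T (S x) → Attached i x → T (S y) → Attached i y →
                    Linked (inj₁ x) (inj₁ y)
  attached-Linked i {x} {y} sx ax sy ay = x , y , refl , refl , attached-ConnIn i sx ax sy ay

  meta-Linked : ∀ i {x} → T (S x) → Attached i x → Linked (inj₂ i) (inj₁ x)
  meta-Linked i {x} sx att = proj₁ att , x , proj₁ (proj₂ att) , refl , attachment-ConnIn i sx att

  HEdge⇒Linked : ∀ {a b} → HEdge comp a b → Linked a b
  HEdge⇒Linked (gEdge x y bx by xy) = x , y , refl , refl , adj⇒ConnIn (inBC⇒S x bx) (inBC⇒S y by) xy
  HEdge⇒Linked (pathEdge i x y c) with Consec⇒∈ c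
  ... | x∈ , y∈ with pathSeq-S-attached i x∈ | pathSeq-S-attached i y∈
  ...   | sx , ax | sy , ay = attached-Linked i sx ax sy ay
  HEdge⇒Linked (metaC i y _ (vc , att)) = meta-Linked i (inBC⇒S y (VC⇒inBC y vc)) att
  HEdge⇒Linked (metaFirst i x _ eq) with pathSeq-S-attached i (head-∈ (pathSeq comp i) eq)
  ... | sx , ax = meta-Linked i sx ax
  HEdge⇒Linked (lowClique i x y _ (vx , ax) (vy , ay)) =
    attached-Linked i (inBC⇒S x (VC⇒inBC x vx)) ax (inBC⇒S y (VC⇒inBC y vy)) ay
  HEdge⇒Linked (lowFirst i x y _ eq (vy , ay)) with pathSeq-S-attached i (head-∈ (pathSeq comp i) eq)
  ... | sx , ax = attached-Linked i sx ax (inBC⇒S y (VC⇒inBC y vy)) ay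

  GStarAdj⇒Linked : ∀ {a b} → GStarAdj comp a b → Linked a b
  GStarAdj⇒Linked (_ , _ , _ , inj₁ e) = HEdge⇒Linked e
  GStarAdj⇒Linked (_ , _ , _ , inj₂ e) = Linked-sym (HEdge⇒Linked e)

  Reaches : Fin n → Vtx comp → Set
  Reaches u a = Σ (Fin n) λ w → Members a w × ConnIn S u w

  Reaches-step : ∀ {u a b} → GStarAdj comp a b → Reaches u a → Reaches u b
  Reaches-step {a = a} ab (w , w∈a , uw@(_ , sw , _)) with GStarAdj⇒Linked ab
  ... | w₁ , w₂ , w₁∈a , w₂∈b , w₁w₂ =
    w₂ , w₂∈b , ConnIn-trans uw (ConnIn-trans (Members-ConnIn a w∈a w₁∈a sw) w₁w₂)

  Reaches-along : ∀ {u a b} → ConnGStar comp a b → Reaches u a → Reaches u b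
  Reaches-along ε        r = r
  Reaches-along (e ◅ es) r = Reaches-along es (Reaches-step e r)

  ConnGStar⇒ConnIn : ∀ {u v} → T (inBC u) → u ⟶* v → ConnIn S u v
  ConnGStar⇒ConnIn {u} bu p with Reaches-along p (u , refl , ConnIn-refl (inBC⇒S u bu))
  ... | _ , refl , uv = uv

lemma3 : ∀ {n : ℕ} (G : Graph n) (S : Fin n → Bool)
           (k : ℕ) (comp : Fin k → List (Fin n)) →
           Construction.IsComponentDecomp G S k comp →
           ∀ (u v : Fin n) →
           T (Construction.inBC G S u) → T (Construction.inBC G S v) →
           (Construction.ConnIn G S S u v ⇔ Construction.ConnGStar G S comp (inj₁ u) (inj₁ v))
lemma3 G S k comp D u v bu bv = mk⇔ (ConnIn⇒ConnGStar bu bv) (ConnGStar⇒ConnIn bu)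
  where open GStarConnectivity G S comp D
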